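{- The star combinatory calculus for arithmetic has the strong normalization property: every term is strongly normalizable.
   Context: Star combinatory calculus for arithmetic: types are generated from the ground type $N$ by $\sigma\to\tau$ and $\sigma^*$. Constants: $0:N$, $S:N\to N$, $R_\sigma:N\to\sigma\to(\sigma\to N\to\sigma)\to\sigma$; $\Pi_{\sigma,\tau}:\sigma\to\tau\to\sigma$; $\Sigma_{\rho,\sigma,\tau}:(\rho\to\sigma\to\tau)\to(\rho\to\sigma)\to\rho\to\tau$; $\mathfrak{s}_\sigma:\sigma\to\sigma^*$; $\cup_\sigma:\sigma^*\to\sigma^*\to\sigma^*$; $\bigcup_{\sigma,\tau}:\sigma^*\to(\sigma\to\tau^*)\to\tau^*$. Terms: constants, typed variables, applications. Conversions: $\Sigma tqr\rightsquigarrow tr(qr)$; $\Pi tq\rightsquigarrow t$; $\bigcup(\mathfrak{s}t)q\rightsquigarrow qt$; $\bigcup(\cup tq)r\rightsquigarrow\cup(\bigcup tr)(\bigcup qr)$; $R0qr\rightsquigarrow q$; $R(St)qr\rightsquigarrow r(Rtqr)t$. A one-step reduction replaces a subterm by its converse according to one conversion. A term is strongly normalizable if there is no infinite chain of one-step reductions starting from it. -}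

module Defs where

open import Data.Nat using (ℕ)
open import Induction.WellFounded using (Acc)

infixr 5 _⇒_
data Ty : Set where
  N   : Ty
  _⇒_ : Ty → Ty → Ty
  _*  : Ty → Ty

infixl 9 _·_
data Tm : Ty → Set where
  var  : ℕ → (σ : Ty) → Tm σ
  O    : Tm N
  S    : Tm (N ⇒ N)
  R    : (σ : Ty) → Tm (N ⇒ σ ⇒ (σ ⇒ N ⇒ σ) ⇒ σ)
  Π    : (σ τ : Ty) → Tm (σ ⇒ τ ⇒ σ)
  Σc   : (ρ σ τ : Ty) → Tm ((ρ ⇒ σ ⇒ τ) ⇒ (ρ ⇒ σ) ⇒ ρ ⇒ τ)
  sing : (σ : Ty) → Tm (σ ⇒ σ *)
  cup  : (σ : Ty) → Tm (σ * ⇒ σ * ⇒ σ *)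
  Cup  : (σ τ : Ty) → Tm (σ * ⇒ (σ ⇒ τ *) ⇒ τ *)
  _·_  : ∀ {σ τ} → Tm (σ ⇒ τ) → Tm σ → Tm τ

infix 4 _↝_ _⟶_
data _↝_ : ∀ {σ} → Tm σ → Tm σ → Set where
  Σ-conv : ∀ {ρ σ τ} (t : Tm (ρ ⇒ σ ⇒ τ)) (q : Tm (ρ ⇒ σ)) (r : Tm ρ) →
           Σc ρ σ τ · t · q · r ↝ t · r · (q · r)
  Π-conv : ∀ {σ τ} (t : Tm σ) (q : Tm τ) → Π σ τ · t · q ↝ t
  ⋃s-conv : ∀ {σ τ} (t : Tm σ) (q : Tm (σ ⇒ τ *)) →
            Cup σ τ · (sing σ · t) · q ↝ q · t
  ⋃∪-conv : ∀ {σ τ} (t q : Tm (σ *)) (r : Tm (σ ⇒ τ *)) →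
            Cup σ τ · (cup σ · t · q) · r ↝ cup τ · (Cup σ τ · t · r) · (Cup σ τ · q · r)
  R0-conv : ∀ {σ} (q : Tm σ) (r : Tm (σ ⇒ N ⇒ σ)) → R σ · O · q · r ↝ q
  RS-conv : ∀ {σ} (t : Tm N) (q : Tm σ) (r : Tm (σ ⇒ N ⇒ σ)) →
            R σ · (S · t) · q · r ↝ r · (R σ · t · q · r) · t

data _⟶_ : ∀ {σ} → Tm σ → Tm σ → Set where
  root : ∀ {σ} {t u : Tm σ} → t ↝ u → t ⟶ u
  appˡ : ∀ {σ τ} {t t' : Tm (σ ⇒ τ)} (u : Tm σ) → t ⟶ t' → t · u ⟶ t' · u
  appʳ : ∀ {σ τ} (t : Tm (σ ⇒ τ)) {u u' : Tm σ} → u ⟶ u' → t · u ⟶ t · u'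

SN : ∀ {σ} → Tm σ → Set
SN {σ} t = Acc (λ u v → v ⟶ u) t

{-# OPTIONS --safe #-}
-- Tait–Girard reducibility. Reducible terms of type N are those accessible
-- for reduction together with S t ↦ t, which is exactly the induction needed
-- for R; reducible terms of type σ * are defined inductively so that their
-- reducts, the element of a singleton and both halves of a union are again
-- reducible, which is the induction needed for ⋃. Reducible terms are strongly
-- normalizable (CR1), closed under reduction (CR2), and a neutral term is
-- reducible as soon as all its reducts are (CR3). Every constant is then
-- reducible by induction on the strong normalizability of its arguments,
-- checking each one-step reduct with CR3, and hence so is every term.
module Submission where

open import Defs
open import Data.Nat using (zero)
open import Data.Empty using (⊥-elim)
open import Relation.Nullary using (¬_)
open import Relation.Binary.PropositionalEquality using (_≡_; refl)
open import Relation.Binary.Construct.On as On using ()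
open import Induction.WellFounded using (Acc; acc; module Subrelation)

-- The terms that may become the head of a redex once applied, or that are
-- built by S, sing or cup: partial applications of constants.
data NonNeutral : ∀ {σ} → Tm σ → Set where
  S₀    : NonNeutral S
  S₁    : ∀ {u} → NonNeutral (S · u)
  Π₀    : ∀ {σ τ} → NonNeutral (Π σ τ)
  Π₁    : ∀ {σ τ t} → NonNeutral (Π σ τ · t)
  Σ₀    : ∀ {ρ σ τ} → NonNeutral (Σc ρ σ τ)
  Σ₁    : ∀ {ρ σ τ t} → NonNeutral (Σc ρ σ τ · t)
  Σ₂    : ∀ {ρ σ τ t q} → NonNeutral (Σc ρ σ τ · t · q)
  R₀    : ∀ {σ} → NonNeutral (R σ)
  R₁    : ∀ {σ n} → NonNeutral (R σ · n)
  R₂    : ∀ {σ n q} → NonNeutral (R σ · n · q)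
  sing₀ : ∀ {σ} → NonNeutral (sing σ)
  sing₁ : ∀ {σ t} → NonNeutral (sing σ · t)
  cup₀  : ∀ {σ} → NonNeutral (cup σ)
  cup₁  : ∀ {σ a} → NonNeutral (cup σ · a)
  cup₂  : ∀ {σ a b} → NonNeutral (cup σ · a · b)
  Cup₀  : ∀ {σ τ} → NonNeutral (Cup σ τ)
  Cup₁  : ∀ {σ τ t} → NonNeutral (Cup σ τ · t)

Neutral : ∀ {σ} → Tm σ → Set
Neutral t = ¬ NonNeutral t

nonNeutral-·ˡ : ∀ {σ τ} {t : Tm (σ ⇒ τ)} {u : Tm σ} →
                NonNeutral (t · u) → NonNeutral t
nonNeutral-·ˡ S₁    = S₀
nonNeutral-·ˡ Π₁    = Π₀
nonNeutral-·ˡ Σ₁    = Σ₀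
nonNeutral-·ˡ Σ₂    = Σ₁
nonNeutral-·ˡ R₁    = R₀
nonNeutral-·ˡ R₂    = R₁
nonNeutral-·ˡ sing₁ = sing₀
nonNeutral-·ˡ cup₁  = cup₀
nonNeutral-·ˡ cup₂  = cup₁
nonNeutral-·ˡ Cup₁  = Cup₀

redex-head-nonNeutral : ∀ {σ τ} {t : Tm (σ ⇒ τ)} {u : Tm σ} {w : Tm τ} →
                        t · u ↝ w → NonNeutral t
redex-head-nonNeutral (Σ-conv _ _ _)  = Σ₂
redex-head-nonNeutral (Π-conv _ _)    = Π₁
redex-head-nonNeutral (⋃s-conv _ _)   = Cup₁
redex-head-nonNeutral (⋃∪-conv _ _ _) = Cup₁
redex-head-nonNeutral (R0-conv _ _)   = R₂
redex-head-nonNeutral (RS-conv _ _ _) = R₂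

neutral-· : ∀ {σ τ} {t : Tm (σ ⇒ τ)} {u : Tm σ} → Neutral t → Neutral (t · u)
neutral-· ne = λ nn → ne (nonNeutral-·ˡ nn)

infix 4 _≺_
data _≺_ : Tm N → Tm N → Set where
  reduct : ∀ {u v} → v ⟶ u → u ≺ v
  S-arg  : ∀ {u} → u ≺ S · u

data RedSet {σ} (P : Tm σ → Set) : Tm (σ *) → Set where
  redSet : ∀ {t} →
           (∀ {t'} → t ⟶ t' → RedSet P t') →
           (∀ {u} → t ≡ sing σ · u → P u) →
           (∀ {a b} → t ≡ cup σ · a · b → RedSet P a) →
           (∀ {a b} → t ≡ cup σ · a · b → RedSet P b) →
           RedSet P t

Reducible : (σ : Ty) → Tm σ → Set
Reducible N       t = Acc _≺_ t
Reducible (σ ⇒ τ) t = ∀ u → Reducible σ u → Reducible τ (t · u)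
Reducible (σ *)   t = RedSet (Reducible σ) t

SN-·ˡ : ∀ {σ τ} {t : Tm (σ ⇒ τ)} (u : Tm σ) → SN (t · u) → SN t
SN-·ˡ u sn = Subrelation.accessible (appˡ u) (On.accessible (_· u) sn)

Acc-≺⇒SN : ∀ {t} → Acc _≺_ t → SN t
Acc-≺⇒SN = Subrelation.accessible reduct

RedSet⇒SN : ∀ {σ} {P : Tm σ → Set} {t} → RedSet P t → SN t
RedSet⇒SN (redSet reducts _ _ _) = acc λ st → RedSet⇒SN (reducts st)

reducible⇒SN : ∀ σ {t} → Reducible σ t → SN t
reducible-⟶  : ∀ σ {t t'} → Reducible σ t → t ⟶ t' → Reducible σ t'
neutral-reducible : ∀ σ {t} → Neutral t →
                    (∀ {t'} → t ⟶ t' → Reducible σ t') → Reducible σ t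

var-reducible : ∀ σ n → Reducible σ (var n σ)
var-reducible σ n = neutral-reducible σ (λ ()) λ { (root ()) }

reducible⇒SN N       r = Acc-≺⇒SN r
reducible⇒SN (σ ⇒ τ) r = SN-·ˡ _ (reducible⇒SN τ (r _ (var-reducible σ zero)))
reducible⇒SN (σ *)   r = RedSet⇒SN r

reducible-⟶ N       (acc r)                st      = r (reduct st)
reducible-⟶ (σ ⇒ τ) r                      st u ru = reducible-⟶ τ (r u ru) (appˡ u st)
reducible-⟶ (σ *)   (redSet reducts _ _ _) st      = reducts st

neutral-reducible N ne h = acc λ
  { (reduct st) → h st
  ; S-arg       → ⊥-elim (ne S₁) }
neutral-reducible (σ *) ne h = redSet h
  (λ { refl → ⊥-elim (ne sing₁) })
  (λ { refl → ⊥-elim (ne cup₂) })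
  (λ { refl → ⊥-elim (ne cup₂) })
neutral-reducible (σ ⇒ τ) {t} ne h u ru = go ru (reducible⇒SN σ ru)
  where
  go : ∀ {u} → Reducible σ u → SN u → Reducible τ (t · u)
  go ru (acc snu) = neutral-reducible τ (neutral-· ne) λ
    { (root c)    → ⊥-elim (ne (redex-head-nonNeutral c))
    ; (appˡ _ st) → h st _ ru
    ; (appʳ _ st) → go (reducible-⟶ σ ru st) (snu st) }

O-reducible : Reducible N O
O-reducible = acc λ { (reduct (root ())) }

S-reducible : ∀ {u} → Reducible N u → Reducible N (S · u)
S-reducible (acc ru) = acc λ
  { (reduct (root ()))
  ; (reduct (appˡ _ (root ())))
  ; (reduct (appʳ _ st)) → S-reducible (ru (reduct st))
  ; S-arg                → acc ru }

Π-reducible : ∀ {σ τ} {t : Tm σ} {q : Tm τ} →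
              Reducible σ t → SN t → Reducible τ q → SN q →
              Reducible σ (Π σ τ · t · q)
Π-reducible {σ} {τ} rt (acc snt) rq (acc snq) = neutral-reducible σ (λ ()) λ
  { (root (Π-conv _ _))        → rt
  ; (appˡ _ (appˡ _ (root ())))
  ; (appˡ _ (root ()))
  ; (appˡ _ (appʳ _ st))       → Π-reducible (reducible-⟶ σ rt st) (snt st) rq (acc snq)
  ; (appʳ _ st)                → Π-reducible rt (acc snt) (reducible-⟶ τ rq st) (snq st) }

Σ-reducible : ∀ {ρ σ τ} {t : Tm (ρ ⇒ σ ⇒ τ)} {q : Tm (ρ ⇒ σ)} {r : Tm ρ} →
              Reducible _ t → SN t → Reducible _ q → SN q → Reducible ρ r → SN r →
              Reducible τ (Σc ρ σ τ · t · q · r)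
Σ-reducible {ρ} {σ} {τ} {q = q} {r} rt (acc snt) rq (acc snq) rr (acc snr) =
  neutral-reducible τ (λ ()) λ
  { (root (Σ-conv _ _ _))               → rt r rr (q · r) (rq r rr)
  ; (appˡ _ (appˡ _ (appˡ _ (root ()))))
  ; (appˡ _ (appˡ _ (root ())))
  ; (appˡ _ (root ()))
  ; (appˡ _ (appˡ _ (appʳ _ st)))       →
      Σ-reducible (reducible-⟶ _ rt st) (snt st) rq (acc snq) rr (acc snr)
  ; (appˡ _ (appʳ _ st))                →
      Σ-reducible rt (acc snt) (reducible-⟶ _ rq st) (snq st) rr (acc snr)
  ; (appʳ _ st)                         →
      Σ-reducible rt (acc snt) rq (acc snq) (reducible-⟶ ρ rr st) (snr st) }

R-reducible : ∀ {σ} {n : Tm N} {q : Tm σ} {r : Tm (σ ⇒ N ⇒ σ)} →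
              Reducible N n → Reducible σ q → SN q → Reducible _ r → SN r →
              Reducible σ (R σ · n · q · r)
R-reducible {σ} (acc rn) rq (acc snq) rr (acc snr) = neutral-reducible σ (λ ()) λ
  { (root (R0-conv _ _))                → rq
  ; (root (RS-conv t _ _))              →
      rr _ (R-reducible (rn S-arg) rq (acc snq) rr (acc snr)) t (rn S-arg)
  ; (appˡ _ (appˡ _ (appˡ _ (root ()))))
  ; (appˡ _ (appˡ _ (root ())))
  ; (appˡ _ (root ()))
  ; (appˡ _ (appˡ _ (appʳ _ st)))       →
      R-reducible (rn (reduct st)) rq (acc snq) rr (acc snr)
  ; (appˡ _ (appʳ _ st))                →
      R-reducible (acc rn) (reducible-⟶ σ rq st) (snq st) rr (acc snr)
  ; (appʳ _ st)                         →
      R-reducible (acc rn) rq (acc snq) (reducible-⟶ _ rr st) (snr st) }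

sing-reducible : ∀ {σ} {t : Tm σ} → Reducible σ t → SN t → Reducible (σ *) (sing σ · t)
sing-reducible {σ} rt (acc snt) = redSet
  (λ { (root ())
     ; (appˡ _ (root ()))
     ; (appʳ _ st) → sing-reducible (reducible-⟶ σ rt st) (snt st) })
  (λ { refl → rt })
  (λ ())
  (λ ())

cup-reducible : ∀ {σ} {a b : Tm (σ *)} →
                Reducible (σ *) a → Reducible (σ *) b → Reducible (σ *) (cup σ · a · b)
cup-reducible {σ} {a} ra@(redSet reductsa _ _ _) = go
  where
  go : ∀ {b} → Reducible (σ *) b → Reducible (σ *) (cup σ · a · b)
  go rb@(redSet reductsb _ _ _) = redSet
    (λ { (root ())
       ; (appˡ _ (root ()))
       ; (appˡ _ (appˡ _ (root ())))
       ; (appˡ _ (appʳ _ st)) → cup-reducible (reductsa st) rb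
       ; (appʳ _ st)          → go (reductsb st) })
    (λ ())
    (λ { refl → ra })
    (λ { refl → rb })

Cup-reducible : ∀ {σ τ} {t : Tm (σ *)} {q : Tm (σ ⇒ τ *)} →
                Reducible (σ *) t → Reducible _ q → SN q → Reducible (τ *) (Cup σ τ · t · q)
Cup-reducible {σ} {τ} {t} (redSet reducts element left right) = go
  where
  go : ∀ {q} → Reducible _ q → SN q → Reducible (τ *) (Cup σ τ · t · q)
  go rq (acc snq) = neutral-reducible (τ *) (λ ()) λ
    { (root (⋃s-conv u _))     → rq u (element refl)
    ; (root (⋃∪-conv _ _ _))   → cup-reducible (Cup-reducible (left refl) rq (acc snq))
                                               (Cup-reducible (right refl) rq (acc snq))
    ; (appˡ _ (appˡ _ (root ())))
    ; (appˡ _ (root ()))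
    ; (appˡ _ (appʳ _ st))     → Cup-reducible (reducts st) rq (acc snq)
    ; (appʳ _ st)              → go (reducible-⟶ _ rq st) (snq st) }

reducible : ∀ {σ} (t : Tm σ) → Reducible σ t
reducible (var n σ)   = var-reducible σ n
reducible O           = O-reducible
reducible S           = λ _ ru → S-reducible ru
reducible (R σ)       = λ _ rn _ rq _ rr → R-reducible rn rq (reducible⇒SN σ rq) rr (reducible⇒SN _ rr)
reducible (Π σ τ)     = λ _ rt _ rq → Π-reducible rt (reducible⇒SN σ rt) rq (reducible⇒SN τ rq)
reducible (Σc ρ σ τ)  = λ _ rt _ rq _ rr →
  Σ-reducible rt (reducible⇒SN _ rt) rq (reducible⇒SN _ rq) rr (reducible⇒SN ρ rr)
reducible (sing σ)    = λ _ rt → sing-reducible rt (reducible⇒SN σ rt)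
reducible (cup σ)     = λ _ ra _ rb → cup-reducible ra rb
reducible (Cup σ τ)   = λ _ rt _ rq → Cup-reducible rt rq (reducible⇒SN _ rq)
reducible (t · u)     = reducible t u (reducible u)

corollary5 : ∀ {σ} (t : Tm σ) → SN t
corollary5 {σ} t = reducible⇒SN σ (reducible t)
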